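{- Suppose $A \in \mathrm{ASM}(n)$ has a submatrix $A' \in \mathrm{ASM}(n-k)$ (obtained by deleting $k$ rows and $k$ columns of $A$). Let $W = \{r_1<\dots< r_k\}$ be the set of indices of rows of $A$ that do not intersect $A'$ and $C = \{c_1<\dots< c_k\}$ the set of indices of columns of $A$ that do not intersect $A'$. Then: (1) For all $i \in [k]$, $A_{r_i, c}=0$ whenever $c < c_1$ or $c>c_k$, and $A_{r,c_i}=0$ whenever $r < r_1$ or $r > r_k$. (2) $\sum_{r \in W, c \in C} A_{r,c} = k$. In particular, there are at least $k$ pairs $(r_i,c_j)$ with $A_{r_i,c_j} = 1$.
   Context: An alternating sign matrix (ASM) of size $n$ is an $n\times n$ matrix with entries in $\{ -1,0,1\}$ such that each row and each column sums to $1$ and the nonzero entries in each row and each column alternate in sign; $\mathrm{ASM}(n)$ is the set of these. -}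

module Defs where

open import Data.Nat using (ℕ; zero; suc)
import Data.Nat
open import Data.Fin using (Fin; zero; suc; _<_)
open import Data.Integer using (ℤ; +_; -_; _+_; 0ℤ; 1ℤ; -1ℤ)
import Data.Integer as ℤ
open import Data.Integer.Properties using () renaming (_≟_ to _≟ℤ_)
open import Data.Product using (_×_)
open import Data.Sum using (_⊎_)
open import Relation.Nullary using (¬_)
open import Relation.Nullary.Decidable using (isYes)
open import Data.Bool using (Bool; true; false)
open import Relation.Binary.PropositionalEquality using (_≡_; _≢_)

Matrix : ℕ → Set
Matrix n = Fin n → Fin n → ℤ

sumFin : {n : ℕ} → (Fin n → ℤ) → ℤ
sumFin {zero}  f = 0ℤ
sumFin {suc n} f = f zero + sumFin (λ i → f (suc i))

countFin : {n : ℕ} → (Fin n → Bool) → ℕ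
countFin {zero}  p = zero
countFin {suc n} p with p zero
... | true  = suc (countFin (λ i → p (suc i)))
... | false = countFin (λ i → p (suc i))

Alternating : {n : ℕ} → (Fin n → ℤ) → Set
Alternating {n} v =
  (a b : Fin n) → a < b → v a ≢ 0ℤ → v b ≢ 0ℤ →
  ((c : Fin n) → a < c → c < b → v c ≡ 0ℤ) →
  v b ≡ - v a

record IsASM {n : ℕ} (A : Matrix n) : Set where
  field
    entries  : (r c : Fin n) → (A r c ≡ 0ℤ) ⊎ (A r c ≡ 1ℤ) ⊎ (A r c ≡ -1ℤ)
    rowSum   : (r : Fin n) → sumFin (λ c → A r c) ≡ 1ℤ
    colSum   : (c : Fin n) → sumFin (λ r → A r c) ≡ 1ℤ
    rowAlt   : (r : Fin n) → Alternating (λ c → A r c)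
    colAlt   : (c : Fin n) → Alternating (λ r → A r c)

StrictlyIncreasing : {m n : ℕ} → (Fin m → Fin n) → Set
StrictlyIncreasing {m} f = (i j : Fin m) → i < j → f i < f j

isOne : ℤ → Bool
isOne x = isYes (x ≟ℤ 1ℤ)

countPairs : {a b : ℕ} → (Fin a → Fin b → Bool) → ℕ
countPairs {zero}  p = zero
countPairs {suc a} p = countFin (p zero) Data.Nat.+ countPairs (λ i → p (suc i))

{-# OPTIONS --safe #-}
-- Let w be a weight on the columns vanishing on the deleted columns C.  Summing ⟨w, row⟩ over
-- all rows of A gives Σ w, since the columns of A sum to 1; summing it over the kept rows gives
-- Σ w as well, since there ⟨w, row⟩ only sees the corresponding row of A′, whose columns also
-- sum to 1.  Hence Σᵢ ⟨w, A_{rᵢ}⟩ = 0.  When w is the indicator of an initial or a final segment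
-- of columns, ⟨w, row⟩ is a partial row sum, which for an ASM row is 0 or 1 (the nonzero entries
-- alternate starting with +1); so if the segment avoids C every ⟨w, A_{rᵢ}⟩ vanishes, and an
-- entry A_{rᵢ,c} with c outside [c₁, c_k] is the difference of two such partial sums.  The column
-- statement is the row statement for the transpose.  For (2), each kept row sums to 1 over the
-- columns of A′, hence to 0 over C, while each column in C sums to 1; so the block W × C sums
-- to k, and as its entries lie in {-1, 0, 1} at least k of them are 1.

module Submission where

open import Defs
open import Data.Nat using (ℕ; zero; suc; _+_; _≥_; z≤n)
import Data.Nat as ℕ
open import Data.Nat.Properties using (_<?_; <⇒≤; ≤⇒≯; m<n⇒m<1+n)
open import Data.Fin using (Fin; zero; suc; toℕ; _<_; splitAt; join; punchIn; punchOut)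
open import Data.Fin.Properties
  using (0≢1+n; suc-injective; toℕ<n; <-cmp; <⇒≢; punchOut-injective; punchIn-punchOut; join-splitAt)
open import Data.Integer using (ℤ; +_; 0ℤ; 1ℤ; -1ℤ; -_; _*_; _≤_; +≤+; -≤+) renaming (_+_ to _+ℤ_)
open import Data.Integer.Properties
  using (_≟_; +-assoc; +-comm; +-identityˡ; +-identityʳ; +-inverseʳ; *-identityˡ; *-identityʳ;
         ≤-refl; ≤-reflexive; ≤-trans; ≤-antisym; +-mono-≤; +-monoʳ-≤; drop‿+≤+; +-*-semiring; +-0-abelianGroup)
open import Algebra.Properties.Semiring.Sum +-*-semiring
  using (sum; sum-cong-≗; sum-replicate-zero; sum-remove; ∑-comm; ∑-distrib-+; *-distribˡ-sum)
open import Algebra.Properties.AbelianGroup +-0-abelianGroup using (identityʳ-unique; ∙-cancelˡ)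
open import Data.Vec.Functional using (Vector; tail; removeAt; _++_)
open import Data.Bool using (Bool; true; false; if_then_else_)
open import Data.Product using (_×_; _,_)
open import Data.Sum as ⊎ using (_⊎_; inj₁; inj₂; [_,_]′)
open import Data.Sum.Properties using ([,]-∘; [,]-map)
open import Function using (_∘_)
open import Function.Definitions using (Injective)
open import Relation.Nullary using (does; yes; no; contradiction)
open import Relation.Nullary.Decidable using (dec-true; dec-false)
open import Relation.Binary.Definitions using (tri<; tri≈; tri>)
open import Relation.Binary.PropositionalEquality
  using (_≡_; _≢_; refl; sym; trans; cong; cong₂; subst; subst₂; module ≡-Reasoning)
open ≡-Reasoning

sumFin≡sum : ∀ {n} (f : Vector ℤ n) → sumFin f ≡ sum f
sumFin≡sum {zero}  f = refl
sumFin≡sum {suc n} f = cong (f zero +ℤ_) (sumFin≡sum (tail f))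

sum-1 : ∀ n → sum {n} (λ _ → 1ℤ) ≡ + n
sum-1 zero    = refl
sum-1 (suc n) = cong (1ℤ +ℤ_) (sum-1 n)

sum-++ : ∀ {m n} (xs : Vector ℤ m) (ys : Vector ℤ n) → sum (xs ++ ys) ≡ sum xs +ℤ sum ys
sum-++ {zero}  xs ys = sym (+-identityˡ (sum ys))
sum-++ {suc m} xs ys = begin
  xs zero +ℤ sum ((xs ++ ys) ∘ suc)     ≡⟨ cong (xs zero +ℤ_) (sum-cong-≗ (λ i → [,]-map (splitAt m i))) ⟩
  xs zero +ℤ sum (tail xs ++ ys)        ≡⟨ cong (xs zero +ℤ_) (sum-++ (tail xs) ys) ⟩
  xs zero +ℤ (sum (tail xs) +ℤ sum ys)  ≡⟨ +-assoc (xs zero) _ _ ⟨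
  sum xs +ℤ sum ys                      ∎

sum-∘-injective : ∀ {n} (f : Vector ℤ n) {h : Fin n → Fin n} → Injective _≡_ _≡_ h → sum (f ∘ h) ≡ sum f
sum-∘-injective {zero}  f         h-inj = refl
sum-∘-injective {suc n} f {h} h-inj = begin
  f h₀ +ℤ sum (f ∘ h ∘ suc)           ≡⟨ cong (f h₀ +ℤ_) (sum-cong-≗ (λ i → cong f (punchIn-punchOut (h₀≢ i)))) ⟨
  f h₀ +ℤ sum (removeAt f h₀ ∘ h′)    ≡⟨ cong (f h₀ +ℤ_) (sum-∘-injective (removeAt f h₀) h′-injective) ⟩
  f h₀ +ℤ sum (removeAt f h₀)         ≡⟨ sum-remove f ⟨
  sum f                               ∎
  where
  h₀ : Fin (suc n)
  h₀ = h zero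
  h₀≢ : ∀ i → h₀ ≢ h (suc i)
  h₀≢ i eq = 0≢1+n (h-inj eq)
  h′ : Fin n → Fin n
  h′ i = punchOut (h₀≢ i)
  h′-injective : Injective _≡_ _≡_ h′
  h′-injective eq = suc-injective (h-inj (punchOut-injective (h₀≢ _) (h₀≢ _) eq))

sum-nonneg : ∀ {n} {f : Vector ℤ n} → (∀ i → 0ℤ ≤ f i) → 0ℤ ≤ sum f
sum-nonneg {zero}  f≥0 = ≤-refl
sum-nonneg {suc n} f≥0 = +-mono-≤ (f≥0 zero) (sum-nonneg (f≥0 ∘ suc))

≤-sum : ∀ {n} {f : Vector ℤ n} → (∀ i → 0ℤ ≤ f i) → ∀ i → f i ≤ sum f
≤-sum {suc n} {f} f≥0 i =
  subst₂ _≤_ (+-identityʳ (f i)) (sym (sum-remove f)) (+-monoʳ-≤ (f i) (sum-nonneg (f≥0 ∘ punchIn i)))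

sum-nonneg-≡0 : ∀ {n} {f : Vector ℤ n} → (∀ i → 0ℤ ≤ f i) → sum f ≡ 0ℤ → ∀ i → f i ≡ 0ℤ
sum-nonneg-≡0 f≥0 Σf≡0 i = ≤-antisym (subst (_ ≤_) Σf≡0 (≤-sum f≥0 i)) (f≥0 i)

[,]-injective : ∀ {A B C : Set} {f : A → C} {g : B → C} →
  Injective _≡_ _≡_ f → Injective _≡_ _≡_ g → (∀ a b → f a ≢ g b) → Injective _≡_ _≡_ [ f , g ]′
[,]-injective f-inj g-inj f≢g {inj₁ a} {inj₁ a′} eq = cong inj₁ (f-inj eq)
[,]-injective f-inj g-inj f≢g {inj₁ a} {inj₂ b}  eq = contradiction eq (f≢g a b)
[,]-injective f-inj g-inj f≢g {inj₂ b} {inj₁ a}  eq = contradiction (sym eq) (f≢g a b)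
[,]-injective f-inj g-inj f≢g {inj₂ b} {inj₂ b′} eq = cong inj₂ (g-inj eq)

++-injective : ∀ {m k n} {ρ : Fin m → Fin n} {ω : Fin k → Fin n} →
  Injective _≡_ _≡_ ρ → Injective _≡_ _≡_ ω → (∀ i j → ρ i ≢ ω j) → Injective _≡_ _≡_ (ρ ++ ω)
++-injective {m} {k} ρ-inj ω-inj ρ≢ω {i} {j} eq = begin
  i                      ≡⟨ join-splitAt m k i ⟨
  join m k (splitAt m i) ≡⟨ cong (join m k) ([,]-injective ρ-inj ω-inj ρ≢ω {splitAt m i} {splitAt m j} eq) ⟩
  join m k (splitAt m j) ≡⟨ join-splitAt m k j ⟩
  j                      ∎

strictlyIncreasing⇒injective : ∀ {m n} {f : Fin m → Fin n} → StrictlyIncreasing f → Injective _≡_ _≡_ f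
strictlyIncreasing⇒injective {f = f} f↑ {i} {j} eq with <-cmp i j
... | tri< i<j _ _ = contradiction eq (<⇒≢ (f↑ i j i<j))
... | tri≈ _ i≡j _ = i≡j
... | tri> _ _ j<i = contradiction (sym eq) (<⇒≢ (f↑ j i j<i))

SumSplits : ∀ {m k n} → (Fin m → Fin n) → (Fin k → Fin n) → Set
SumSplits {n = n} ρ ω = (f : Vector ℤ n) → sum f ≡ sum (f ∘ ρ) +ℤ sum (f ∘ ω)

sum-splits : ∀ {m k} {ρ : Fin m → Fin (m + k)} {ω : Fin k → Fin (m + k)} →
  Injective _≡_ _≡_ ρ → Injective _≡_ _≡_ ω → (∀ i j → ρ i ≢ ω j) → SumSplits ρ ω
sum-splits {m} {ρ = ρ} {ω} ρ-inj ω-inj ρ≢ω f = begin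
  sum f                         ≡⟨ sum-∘-injective f (++-injective ρ-inj ω-inj ρ≢ω) ⟨
  sum (f ∘ (ρ ++ ω))            ≡⟨ sum-cong-≗ (λ i → [,]-∘ f (splitAt m i)) ⟩
  sum ((f ∘ ρ) ++ (f ∘ ω))      ≡⟨ sum-++ (f ∘ ρ) (f ∘ ω) ⟩
  sum (f ∘ ρ) +ℤ sum (f ∘ ω)    ∎

_·_ : ∀ {n} → Vector ℤ n → Vector ℤ n → ℤ
w · v = sum (λ c → w c * v c)

infix 8 _·_

∑-·-columns : ∀ {a b} (M : Fin a → Vector ℤ b) → (∀ c → sum (λ r → M r c) ≡ 1ℤ) →
  (w : Vector ℤ b) → sum (λ r → w · M r) ≡ sum w
∑-·-columns M colSum w = begin
  sum (λ r → sum (λ c → w c * M r c))   ≡⟨ ∑-comm (λ r c → w c * M r c) ⟩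
  sum (λ c → sum (λ r → w c * M r c))   ≡⟨ sum-cong-≗ (λ c → *-distribˡ-sum (w c) (λ r → M r c)) ⟨
  sum (λ c → w c * sum (λ r → M r c))   ≡⟨ sum-cong-≗ (λ c → cong (w c *_) (colSum c)) ⟩
  sum (λ c → w c * 1ℤ)                  ≡⟨ sum-cong-≗ (λ c → *-identityʳ (w c)) ⟩
  sum w                                 ∎

prefix suffix : ∀ {N} → ℕ → Vector ℤ N
prefix n c = if does (toℕ c <? n) then 1ℤ else 0ℤ
suffix n c = if does (toℕ c <? n) then 0ℤ else 1ℤ

prefix-< : ∀ {N n} {c : Fin N} → toℕ c ℕ.< n → prefix n c ≡ 1ℤ
prefix-< {n = n} {c} c<n = cong (if_then 1ℤ else 0ℤ) (dec-true (toℕ c <? n) c<n)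

prefix-≥ : ∀ {N n} {c : Fin N} → n ℕ.≤ toℕ c → prefix n c ≡ 0ℤ
prefix-≥ {n = n} {c} n≤c = cong (if_then 1ℤ else 0ℤ) (dec-false (toℕ c <? n) (≤⇒≯ n≤c))

suffix-< : ∀ {N n} {c : Fin N} → toℕ c ℕ.< n → suffix n c ≡ 0ℤ
suffix-< {n = n} {c} c<n = cong (if_then 0ℤ else 1ℤ) (dec-true (toℕ c <? n) c<n)

prefix-zero-· : ∀ {N} (v : Vector ℤ N) → prefix 0 · v ≡ 0ℤ
prefix-zero-· {N} v = sum-replicate-zero N

prefix-suc-· : ∀ {N} n (v : Vector ℤ (suc N)) → prefix (suc n) · v ≡ v zero +ℤ prefix n · tail v
prefix-suc-· n v = cong (_+ℤ prefix n · tail v) (*-identityˡ (v zero))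

prefix-full-· : ∀ {N} (v : Vector ℤ N) → prefix N · v ≡ sum v
prefix-full-· v = sum-cong-≗ (λ c → trans (cong (_* v c) (prefix-< (toℕ<n c))) (*-identityˡ (v c)))

prefix-step : ∀ {N} (v : Vector ℤ N) (c : Fin N) → prefix (suc (toℕ c)) · v ≡ prefix (toℕ c) · v +ℤ v c
prefix-step v zero = begin
  prefix 1 · v                  ≡⟨ prefix-suc-· 0 v ⟩
  v zero +ℤ prefix 0 · tail v   ≡⟨ cong (v zero +ℤ_) (prefix-zero-· (tail v)) ⟩
  v zero +ℤ 0ℤ                  ≡⟨ +-comm (v zero) 0ℤ ⟩
  0ℤ +ℤ v zero                  ≡⟨ cong (_+ℤ v zero) (prefix-zero-· v) ⟨
  prefix 0 · v +ℤ v zero        ∎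
prefix-step v (suc c) = begin
  prefix (suc (suc (toℕ c))) · v                     ≡⟨ prefix-suc-· (suc (toℕ c)) v ⟩
  v zero +ℤ prefix (suc (toℕ c)) · tail v            ≡⟨ cong (v zero +ℤ_) (prefix-step (tail v) c) ⟩
  v zero +ℤ (prefix (toℕ c) · tail v +ℤ v (suc c))   ≡⟨ +-assoc (v zero) (prefix (toℕ c) · tail v) (v (suc c)) ⟨
  v zero +ℤ prefix (toℕ c) · tail v +ℤ v (suc c)     ≡⟨ cong (_+ℤ v (suc c)) (prefix-suc-· (toℕ c) v) ⟨
  prefix (suc (toℕ c)) · v +ℤ v (suc c)              ∎

prefix-+-suffix : ∀ {N} n (v : Vector ℤ N) → prefix n · v +ℤ suffix n · v ≡ sum v
prefix-+-suffix n v = trans (sym (∑-distrib-+ (λ c → prefix n c * v c) (λ c → suffix n c * v c))) (sum-cong-≗ split)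
  where
  split : ∀ c → prefix n c * v c +ℤ suffix n c * v c ≡ v c
  split c with does (toℕ c <? n)
  ... | true  = trans (+-identityʳ _) (*-identityˡ (v c))
  ... | false = trans (+-identityˡ _) (*-identityˡ (v c))

suffix-step : ∀ {N} (v : Vector ℤ N) (c : Fin N) → suffix (toℕ c) · v ≡ suffix (suc (toℕ c)) · v +ℤ v c
suffix-step v c = ∙-cancelˡ (prefix (toℕ c) · v) _ _ (begin
  p +ℤ suffix (toℕ c) · v                   ≡⟨ prefix-+-suffix (toℕ c) v ⟩
  sum v                                     ≡⟨ prefix-+-suffix (suc (toℕ c)) v ⟨
  prefix (suc (toℕ c)) · v +ℤ s′            ≡⟨ cong (_+ℤ s′) (prefix-step v c) ⟩
  p +ℤ v c +ℤ s′                            ≡⟨ +-assoc p (v c) s′ ⟩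
  p +ℤ (v c +ℤ s′)                          ≡⟨ cong (p +ℤ_) (+-comm (v c) s′) ⟩
  p +ℤ (s′ +ℤ v c)                          ∎)
  where
  p s′ : ℤ
  p  = prefix (toℕ c) · v
  s′ = suffix (suc (toℕ c)) · v

LeadingNonzero : ∀ {N} → Vector ℤ N → ℤ → Set
LeadingNonzero {N} v e = (b : Fin N) → v b ≢ 0ℤ → (∀ c → c < b → v c ≡ 0ℤ) → v b ≡ e

first-nonzero-leads : ∀ {N} {v : Vector ℤ N} {b : Fin N} →
  v b ≢ 0ℤ → (∀ c → c < b → v c ≡ 0ℤ) → LeadingNonzero v (v b)
first-nonzero-leads {b = b} vb≢0 before b′ vb′≢0 before′ with <-cmp b′ b
... | tri< b′<b _ _ = contradiction (before b′ b′<b) vb′≢0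
... | tri≈ _ b′≡b _ = cong _ b′≡b
... | tri> _ _ b<b′ = contradiction (before′ b b<b′) vb≢0

alternating-tail : ∀ {N} {v : Vector ℤ (suc N)} → Alternating v → Alternating (tail v)
alternating-tail {v = v} alt a b a<b va≢0 vb≢0 between = alt (suc a) (suc b) (ℕ.s<s a<b) va≢0 vb≢0 between′
  where
  between′ : ∀ c → suc a < c → c < suc b → v c ≡ 0ℤ
  between′ zero    ()        _
  between′ (suc c) (ℕ.s<s a<c) (ℕ.s<s c<b) = between c a<c c<b

leading-tail-zero : ∀ {N} {v : Vector ℤ (suc N)} {e} →
  v zero ≡ 0ℤ → LeadingNonzero v e → LeadingNonzero (tail v) e
leading-tail-zero {v = v} v₀≡0 lead b vb≢0 before = lead (suc b) vb≢0 before′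
  where
  before′ : ∀ c → c < suc b → v c ≡ 0ℤ
  before′ zero    _           = v₀≡0
  before′ (suc c) (ℕ.s<s c<b) = before c c<b

leading-tail-nonzero : ∀ {N} {v : Vector ℤ (suc N)} {e} → Alternating v →
  v zero ≢ 0ℤ → LeadingNonzero v e → LeadingNonzero (tail v) (- e)
leading-tail-nonzero {N} {v} alt v₀≢0 lead b vb≢0 before =
  trans (alt zero (suc b) ℕ.z<s v₀≢0 vb≢0 between) (cong -_ (lead zero v₀≢0 (λ _ ())))
  where
  between : ∀ c → zero {N} < c → c < suc b → v c ≡ 0ℤ
  between zero    ()  _
  between (suc c) _   (ℕ.s<s c<b) = before c c<b

prefix-·-alternating : ∀ {N} {v : Vector ℤ N} {e} → Alternating v → LeadingNonzero v e →
  ∀ n → prefix n · v ≡ 0ℤ ⊎ prefix n · v ≡ e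
prefix-·-alternating {zero}          _   _    n       = inj₁ refl
prefix-·-alternating {suc N} {v}     _   _    zero    = inj₁ (prefix-zero-· v)
prefix-·-alternating {suc N} {v} {e} alt lead (suc n) with v zero ≟ 0ℤ
... | yes v₀≡0 = ⊎.map (trans shift) (trans shift)
        (prefix-·-alternating (alternating-tail alt) (leading-tail-zero v₀≡0 lead) n)
  where
  shift : prefix (suc n) · v ≡ prefix n · tail v
  shift = trans (prefix-suc-· n v) (trans (cong (_+ℤ prefix n · tail v) v₀≡0) (+-identityˡ _))
... | no v₀≢0 =
  [ (λ p′≡0  → inj₂ (trans (shift p′≡0) (+-identityʳ e)))
  , (λ p′≡-e → inj₁ (trans (shift p′≡-e) (+-inverseʳ e)))
  ]′ (prefix-·-alternating (alternating-tail alt) (leading-tail-nonzero alt v₀≢0 lead) n)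
  where
  shift : ∀ {x} → prefix n · tail v ≡ x → prefix (suc n) · v ≡ e +ℤ x
  shift p′≡x = trans (prefix-suc-· n v) (cong₂ _+ℤ_ (lead zero v₀≢0 (λ _ ())) p′≡x)

leading-nonzero-one : ∀ {N} {v : Vector ℤ N} → Alternating v → sum v ≡ 1ℤ → LeadingNonzero v 1ℤ
leading-nonzero-one {N} {v} alt Σv≡1 b vb≢0 before =
  [ (λ full≡0  → contradiction (trans (sym Σv≡1) (trans (sym (prefix-full-· v)) full≡0)) λ ())
  , (λ full≡vb → trans (sym full≡vb) (trans (prefix-full-· v) Σv≡1))
  ]′ (prefix-·-alternating alt (first-nonzero-leads vb≢0 before) N)

module AlternatingSumOne {N} {v : Vector ℤ N} (alt : Alternating v) (Σv≡1 : sum v ≡ 1ℤ) where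

  prefix-·-∈01 : ∀ n → prefix n · v ≡ 0ℤ ⊎ prefix n · v ≡ 1ℤ
  prefix-·-∈01 = prefix-·-alternating alt (leading-nonzero-one alt Σv≡1)

  suffix-·-∈01 : ∀ n → suffix n · v ≡ 0ℤ ⊎ suffix n · v ≡ 1ℤ
  suffix-·-∈01 n = ⊎.swap (⊎.map
    (λ p≡0 → trans (sym (+-identityˡ _)) (trans (cong (_+ℤ suffix n · v) (sym p≡0)) p+s≡1))
    (λ p≡1 → identityʳ-unique 1ℤ _ (trans (cong (_+ℤ suffix n · v) (sym p≡1)) p+s≡1))
    (prefix-·-∈01 n))
    where
    p+s≡1 : prefix n · v +ℤ suffix n · v ≡ 1ℤ
    p+s≡1 = trans (prefix-+-suffix n v) Σv≡1

0or1⇒nonneg : ∀ {x} → x ≡ 0ℤ ⊎ x ≡ 1ℤ → 0ℤ ≤ x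
0or1⇒nonneg (inj₁ refl) = ≤-refl
0or1⇒nonneg (inj₂ refl) = +≤+ z≤n

IsASM-transpose : ∀ {n} {A : Matrix n} → IsASM A → IsASM (λ r c → A c r)
IsASM-transpose isASM = record
  { entries = λ r c → entries c r ; rowSum = colSum ; colSum = rowSum ; rowAlt = colAlt ; colAlt = rowAlt }
  where open IsASM isASM

module ASMProperties {N} {A : Matrix N} (isASM : IsASM A) where
  open IsASM isASM

  row-sum : ∀ r → sum (A r) ≡ 1ℤ
  row-sum r = trans (sym (sumFin≡sum (A r))) (rowSum r)

  col-sum : ∀ c → sum (λ r → A r c) ≡ 1ℤ
  col-sum c = trans (sym (sumFin≡sum (λ r → A r c))) (colSum c)

  prefix-row-nonneg : ∀ r n → 0ℤ ≤ prefix n · A r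
  prefix-row-nonneg r n = 0or1⇒nonneg (AlternatingSumOne.prefix-·-∈01 (rowAlt r) (row-sum r) n)

  suffix-row-nonneg : ∀ r n → 0ℤ ≤ suffix n · A r
  suffix-row-nonneg r n = 0or1⇒nonneg (AlternatingSumOne.suffix-·-∈01 (rowAlt r) (row-sum r) n)

≤-isOne : ∀ {x} → x ≡ 0ℤ ⊎ x ≡ 1ℤ ⊎ x ≡ -1ℤ → x ≤ (if isOne x then 1ℤ else 0ℤ)
≤-isOne (inj₁ refl)        = ≤-refl
≤-isOne (inj₂ (inj₁ refl)) = ≤-refl
≤-isOne (inj₂ (inj₂ refl)) = -≤+

sum-≤-countFin : ∀ {n} (p : Fin n → Bool) {v : Vector ℤ n} →
  (∀ i → v i ≤ (if p i then 1ℤ else 0ℤ)) → sum v ≤ + countFin p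
sum-≤-countFin {zero}  p v≤p = ≤-refl
sum-≤-countFin {suc n} p v≤p with p zero | v≤p zero
... | true  | v₀≤1 = +-mono-≤ v₀≤1 (sum-≤-countFin (p ∘ suc) (v≤p ∘ suc))
... | false | v₀≤0 = +-mono-≤ v₀≤0 (sum-≤-countFin (p ∘ suc) (v≤p ∘ suc))

sum²-≤-countPairs : ∀ {a b} (M : Fin a → Fin b → ℤ) → (∀ i j → M i j ≡ 0ℤ ⊎ M i j ≡ 1ℤ ⊎ M i j ≡ -1ℤ) →
  sum (λ i → sum (M i)) ≤ + countPairs (λ i j → isOne (M i j))
sum²-≤-countPairs {zero}  M M∈ = ≤-refl
sum²-≤-countPairs {suc a} M M∈ =
  +-mono-≤ (sum-≤-countFin _ (λ j → ≤-isOne (M∈ zero j))) (sum²-≤-countPairs (M ∘ suc) (M∈ ∘ suc))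

module Deletion {m k} (A : Matrix (m + k)) (isA : IsASM A)
  (ρ γ : Fin m → Fin (m + k)) (isA′ : IsASM (λ i j → A (ρ i) (γ j)))
  (ω δ : Fin k → Fin (m + k)) (rows : SumSplits ρ ω) (cols : SumSplits γ δ) where

  open ASMProperties isA
  module A′ = ASMProperties isA′

  sum-kept-cols : (g : Vector ℤ (m + k)) → (∀ j → g (δ j) ≡ 0ℤ) → sum g ≡ sum (g ∘ γ)
  sum-kept-cols g g∘δ≡0 = begin
    sum g                        ≡⟨ cols g ⟩
    sum (g ∘ γ) +ℤ sum (g ∘ δ)   ≡⟨ cong (sum (g ∘ γ) +ℤ_) (trans (sum-cong-≗ g∘δ≡0) (sum-replicate-zero k)) ⟩
    sum (g ∘ γ) +ℤ 0ℤ            ≡⟨ +-identityʳ _ ⟩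
    sum (g ∘ γ)                  ∎

  ∑-deleted-rows-·≡0 : (w : Vector ℤ (m + k)) → (∀ j → w (δ j) ≡ 0ℤ) → sum (λ i → w · A (ω i)) ≡ 0ℤ
  ∑-deleted-rows-·≡0 w w∘δ≡0 = identityʳ-unique (sum w) _ (begin
    sum w +ℤ sum (λ i → w · A (ω i))                        ≡⟨ cong (_+ℤ sum (λ i → w · A (ω i))) kept-rows ⟨
    sum (λ i → w · A (ρ i)) +ℤ sum (λ i → w · A (ω i))      ≡⟨ rows (λ r → w · A r) ⟨
    sum (λ r → w · A r)                                     ≡⟨ ∑-·-columns A col-sum w ⟩
    sum w                                                   ∎)
    where
    kept-rows : sum (λ i → w · A (ρ i)) ≡ sum w
    kept-rows = begin
      sum (λ i → w · A (ρ i))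
        ≡⟨ sum-cong-≗ (λ i → sum-kept-cols (λ c → w c * A (ρ i) c) (λ j → cong (_* A (ρ i) (δ j)) (w∘δ≡0 j))) ⟩
      sum (λ i → (w ∘ γ) · (λ j → A (ρ i) (γ j)))   ≡⟨ ∑-·-columns (λ i j → A (ρ i) (γ j)) A′.col-sum (w ∘ γ) ⟩
      sum (w ∘ γ)                                   ≡⟨ sum-kept-cols w w∘δ≡0 ⟨
      sum w                                         ∎

  deleted-row-·≡0 : (w : Vector ℤ (m + k)) → (∀ j → w (δ j) ≡ 0ℤ) → (∀ r → 0ℤ ≤ w · A r) →
    ∀ i → w · A (ω i) ≡ 0ℤ
  deleted-row-·≡0 w w∘δ≡0 w·A≥0 = sum-nonneg-≡0 (w·A≥0 ∘ ω) (∑-deleted-rows-·≡0 w w∘δ≡0)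

  entry-left-of-deleted : ∀ i c → (∀ j → c < δ j) → A (ω i) c ≡ 0ℤ
  entry-left-of-deleted i c c<δ = begin
    A (ω i) c                              ≡⟨ +-identityˡ _ ⟨
    0ℤ +ℤ A (ω i) c                        ≡⟨ cong (_+ℤ A (ω i) c) (vanishes (toℕ c) (<⇒≤ ∘ c<δ)) ⟨
    prefix (toℕ c) · A (ω i) +ℤ A (ω i) c  ≡⟨ prefix-step (A (ω i)) c ⟨
    prefix (suc (toℕ c)) · A (ω i)         ≡⟨ vanishes (suc (toℕ c)) c<δ ⟩
    0ℤ                                     ∎
    where
    vanishes : ∀ n → (∀ j → n ℕ.≤ toℕ (δ j)) → prefix n · A (ω i) ≡ 0ℤ
    vanishes n n≤δ = deleted-row-·≡0 (prefix n) (λ j → prefix-≥ (n≤δ j)) (λ r → prefix-row-nonneg r n) i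

  entry-right-of-deleted : ∀ i c → (∀ j → δ j < c) → A (ω i) c ≡ 0ℤ
  entry-right-of-deleted i c δ<c = begin
    A (ω i) c                                    ≡⟨ +-identityˡ _ ⟨
    0ℤ +ℤ A (ω i) c                              ≡⟨ cong (_+ℤ A (ω i) c) (vanishes (suc (toℕ c)) (m<n⇒m<1+n ∘ δ<c)) ⟨
    suffix (suc (toℕ c)) · A (ω i) +ℤ A (ω i) c  ≡⟨ suffix-step (A (ω i)) c ⟨
    suffix (toℕ c) · A (ω i)                     ≡⟨ vanishes (toℕ c) δ<c ⟩
    0ℤ                                           ∎
    where
    vanishes : ∀ n → (∀ j → toℕ (δ j) ℕ.< n) → suffix n · A (ω i) ≡ 0ℤ
    vanishes n δ<n = deleted-row-·≡0 (suffix n) (λ j → suffix-< (δ<n j)) (λ r → suffix-row-nonneg r n) i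

  deleted-row-outside : ∀ i c → (∀ j → c < δ j) ⊎ (∀ j → δ j < c) → A (ω i) c ≡ 0ℤ
  deleted-row-outside i c = [ entry-left-of-deleted i c , entry-right-of-deleted i c ]′

  kept-row-deleted-cols : ∀ i → sum (A (ρ i) ∘ δ) ≡ 0ℤ
  kept-row-deleted-cols i = identityʳ-unique 1ℤ _ (begin
    1ℤ +ℤ sum (A (ρ i) ∘ δ)                  ≡⟨ cong (_+ℤ sum (A (ρ i) ∘ δ)) (A′.row-sum i) ⟨
    sum (A (ρ i) ∘ γ) +ℤ sum (A (ρ i) ∘ δ)   ≡⟨ cols (A (ρ i)) ⟨
    sum (A (ρ i))                            ≡⟨ row-sum (ρ i) ⟩
    1ℤ                                       ∎)

  deleted-block-sum : sum (λ i → sum (λ j → A (ω i) (δ j))) ≡ + k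
  deleted-block-sum = begin
    sum (λ i → sum (λ j → A (ω i) (δ j)))         ≡⟨ ∑-comm (λ i j → A (ω i) (δ j)) ⟩
    Σωδ                                           ≡⟨ +-identityˡ Σωδ ⟨
    0ℤ +ℤ Σωδ                                     ≡⟨ cong (_+ℤ Σωδ) kept-rows ⟨
    sum (λ j → sum (λ i → A (ρ i) (δ j))) +ℤ Σωδ  ≡⟨ ∑-distrib-+ (λ j → sum (λ i → A (ρ i) (δ j))) (λ j → sum (λ i → A (ω i) (δ j))) ⟨
    sum (λ j → sum (λ i → A (ρ i) (δ j)) +ℤ sum (λ i → A (ω i) (δ j)))
      ≡⟨ sum-cong-≗ (λ j → trans (sym (rows (λ r → A r (δ j)))) (col-sum (δ j))) ⟩
    sum {k} (λ _ → 1ℤ)                            ≡⟨ sum-1 k ⟩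
    + k                                           ∎
    where
    Σωδ : ℤ
    Σωδ = sum (λ j → sum (λ i → A (ω i) (δ j)))
    kept-rows : sum (λ j → sum (λ i → A (ρ i) (δ j))) ≡ 0ℤ
    kept-rows = trans (sym (∑-comm (λ i j → A (ρ i) (δ j))))
                      (trans (sum-cong-≗ kept-row-deleted-cols) (sum-replicate-zero m))

proposition4p3 : (m k : ℕ) (A : Matrix (m + k)) →
    IsASM A →
    (ρ γ : Fin m → Fin (m + k)) → StrictlyIncreasing ρ → StrictlyIncreasing γ →
    IsASM (λ i j → A (ρ i) (γ j)) →
    (ω δ : Fin k → Fin (m + k)) → StrictlyIncreasing ω → StrictlyIncreasing δ →
    ((i : Fin m) (j : Fin k) → ρ i ≢ ω j) →
    ((i : Fin m) (j : Fin k) → γ i ≢ δ j) →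
    (((i : Fin k) (c : Fin (m + k)) →
        ((∀ j → c < δ j) ⊎ (∀ j → δ j < c)) → A (ω i) c ≡ 0ℤ)
     × ((i : Fin k) (r : Fin (m + k)) →
        ((∀ j → r < ω j) ⊎ (∀ j → ω j < r)) → A r (δ i) ≡ 0ℤ))
    × (sumFin (λ i → sumFin (λ j → A (ω i) (δ j))) ≡ + k)
    × (countPairs (λ i j → isOne (A (ω i) (δ j))) ≥ k)
proposition4p3 m k A isA ρ γ ρ↑ γ↑ isA′ ω δ ω↑ δ↑ ρ≢ω γ≢δ =
  (Rows.deleted-row-outside , Cols.deleted-row-outside) , block-sum , k≤count
  where
  rows : SumSplits ρ ω
  rows = sum-splits (strictlyIncreasing⇒injective ρ↑) (strictlyIncreasing⇒injective ω↑) ρ≢ω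
  cols : SumSplits γ δ
  cols = sum-splits (strictlyIncreasing⇒injective γ↑) (strictlyIncreasing⇒injective δ↑) γ≢δ
  module Rows = Deletion A isA ρ γ isA′ ω δ rows cols
  module Cols = Deletion (λ r c → A c r) (IsASM-transpose isA) γ ρ (IsASM-transpose isA′) δ ω cols rows
  block-sum : sumFin (λ i → sumFin (λ j → A (ω i) (δ j))) ≡ + k
  block-sum = begin
    sumFin (λ i → sumFin (λ j → A (ω i) (δ j)))   ≡⟨ sumFin≡sum (λ i → sumFin (λ j → A (ω i) (δ j))) ⟩
    sum (λ i → sumFin (λ j → A (ω i) (δ j)))      ≡⟨ sum-cong-≗ (λ i → sumFin≡sum (λ j → A (ω i) (δ j))) ⟩
    sum (λ i → sum (λ j → A (ω i) (δ j)))         ≡⟨ Rows.deleted-block-sum ⟩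
    + k                                           ∎
  k≤count : countPairs (λ i j → isOne (A (ω i) (δ j))) ≥ k
  k≤count = drop‿+≤+ (≤-trans (≤-reflexive (sym Rows.deleted-block-sum))
    (sum²-≤-countPairs (λ i j → A (ω i) (δ j)) (λ i j → IsASM.entries isA (ω i) (δ j))))
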